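{- Let $G$ be a bipartite graph such that $d_G(v)\in\{1,2,4,6,7,8\}$ for every vertex $v\in V(G)$. Then $G$ has a cyclic interval coloring, i.e. a cyclic interval $t$-coloring for some positive integer $t$.
   Context: All graphs are finite and undirected; multiple edges are allowed, loops are not. A proper $t$-edge coloring of $G$ is a map $\alpha:E(G)\to\{1,\dots,t\}$ with $\alpha(e)\neq\alpha(e')$ for adjacent edges $e,e'$; $S(v,\alpha)$ is the set of colors on edges incident to $v$. A proper $t$-edge coloring $\alpha$ is a cyclic interval $t$-coloring if for every vertex $v$, either $S(v,\alpha)$ or $\{1,\dots,t\}\setminus S(v,\alpha)$ is a set of consecutive integers. -}

module Defs where

open import Data.Nat using (ℕ; _≤_; _<_)
open import Data.Fin using (Fin)
open import Data.Bool using (Bool)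
open import Data.Product using (Σ; ∃; ∃-syntax; _×_; _,_; proj₁; proj₂)
open import Data.Sum using (_⊎_)
open import Data.List using (List; length; filter)
open import Data.List using () renaming (allFin to allFinL)
open import Data.Vec using (allFin; toList)
open import Relation.Binary.PropositionalEquality using (_≡_; _≢_)
open import Relation.Nullary using (¬_; Dec)
open import Relation.Nullary.Decidable using (_⊎-dec_)
open import Data.Fin using (_≟_)
open import Function.Bundles using (_⇔_)

record Graph : Set where
  field
    n     : ℕ
    m     : ℕ
    ends  : Fin m → Fin n × Fin n
    loopless : ∀ e → proj₁ (ends e) ≢ proj₂ (ends e)

open Graph public

Incident : (G : Graph) → Fin (m G) → Fin (n G) → Set
Incident G e v = (proj₁ (ends G e) ≡ v) ⊎ (proj₂ (ends G e) ≡ v)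

incident? : (G : Graph) → (e : Fin (m G)) → (v : Fin (n G)) → Dec (Incident G e v)
incident? G e v = (proj₁ (ends G e) ≟ v) ⊎-dec (proj₂ (ends G e) ≟ v)

-- degree: number of edges incident to v (each edge counted once; no loops)
degree : (G : Graph) → Fin (n G) → ℕ
degree G v = length (filter (λ e → incident? G e v) (toList (allFin (m G))))

Bipartite : Graph → Set
Bipartite G = Σ (Fin (n G) → Bool) λ side →
  ∀ e → side (proj₁ (ends G e)) ≢ side (proj₂ (ends G e))

Adjacent : (G : Graph) → Fin (m G) → Fin (m G) → Set
Adjacent G e e' = e ≢ e' × ∃[ v ] (Incident G e v × Incident G e' v)

ProperColoring : (G : Graph) → ℕ → (Fin (m G) → ℕ) → Set
ProperColoring G t α =
  (∀ e → 1 ≤ α e × α e ≤ t) ×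
  (∀ e e' → Adjacent G e e' → α e ≢ α e')

InS : (G : Graph) → (Fin (m G) → ℕ) → Fin (n G) → ℕ → Set
InS G α v c = ∃[ e ] (Incident G e v × α e ≡ c)

-- a set of natural numbers (given as a predicate) is a set of consecutive integers
-- (an interval [a, b]; the empty set is included via a > b)
Consecutive : (ℕ → Set) → Set
Consecutive S = ∃[ a ] ∃[ b ] (∀ c → S c ⇔ (a ≤ c × c ≤ b))

CyclicIntervalColoring : (G : Graph) → ℕ → (Fin (m G) → ℕ) → Set
CyclicIntervalColoring G t α =
  ProperColoring G t α ×
  (∀ v → Consecutive (InS G α v)
       ⊎ Consecutive (λ c → (1 ≤ c × c ≤ t) × ¬ InS G α v c))

-- A colour is a bit together with a class in Bool × Bool, so there are eight colours, and every
-- Boolean choice comes from one switching lemma: if the two ends of each element are placed in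
-- disjoint pairs, the elements can be oriented so that every pair has one in-end and one out-end
-- (the pairs link the elements into paths and cycles). Applied to the edges paired up at each
-- vertex, it gives an orientation in which out- and in-degree differ by at most one. Each side
-- (out-edges, in-edges) of a vertex of even degree is padded with virtual slots, shared by both
-- sides, to four slots; two more applications give slot classes distinct on every side, hence all
-- four classes on a full side. A last application, pairing the at most two edges of one class at a
-- vertex, gives every edge a bit, which the bipartition makes independent of the chosen endpoint;
-- edges of one class at a vertex then get different bits, so the colouring is proper.
-- At a vertex of even degree both sides carry the same classes, so the colours present form
-- whole blocks {2i + 1, 2i + 2}: one block (degree 2), two cyclically adjacent blocks (degree 4),
-- all but one block (degree 6) or all colours (degree 8). At degree 7 one side meets all classes
-- and the other all but one, so exactly one colour is missing; at degree 1 one colour is present.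

module Submission where

open import Defs

open import Data.Bool using (Bool; true; false; not; _xor_)
import Data.Bool.Properties as Bool
open import Data.Empty using (⊥-elim)
open import Data.Fin as Fin using (Fin; zero; toℕ; fromℕ<)
import Data.Fin.Properties as Fin
open import Data.List
  using (List; []; _∷_; _++_; map; concat; concatMap; filter; length; take; allFin; tabulate; cartesianProduct)
open import Data.List.Membership.Propositional using (_∈_)
open import Data.List.Membership.Propositional.Properties
  using (∈-filter⁺; ∈-filter⁻; ∈-map⁺; ∈-map⁻; ∈-++⁺ˡ; ∈-++⁺ʳ; ∈-++⁻; ∈-allFin; ∈-cartesianProduct⁺)
open import Data.List.Properties using (length-++; length-map; length-filter)
open import Data.List.Relation.Binary.Disjoint.Propositional using (Disjoint)
open import Data.List.Relation.Unary.All as All using (All; []; _∷_)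
import Data.List.Relation.Unary.All.Properties as All
import Data.List.Relation.Unary.AllPairs as AllPairs
import Data.List.Relation.Unary.AllPairs.Properties as AllPairs
open import Data.List.Relation.Unary.Any using (here; there)
import Data.List.Relation.Unary.Any.Properties as Any
open import Data.List.Relation.Unary.Unique.Propositional using (Unique; []; _∷_)
import Data.List.Relation.Unary.Unique.Propositional.Properties as Unique
open import Data.Nat as ℕ using (ℕ; zero; suc; _+_; _≤_; _≤?_; z≤n; s≤s; ⌈_/2⌉; ⌊_/2⌋)
open import Data.Nat.Properties
  using ( ≤-refl; ≤-reflexive; ≤-trans; ≤-antisym; ≤-pred; ≤∧≢⇒<; +-comm; +-suc; +-identityʳ
        ; +-monoˡ-≤; +-monoʳ-≤; +-cancelˡ-≤; +-cancelʳ-≤; +-cancelˡ-≡; +-cancelʳ-≡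
        ; n≡⌊n+n/2⌋; ⌈n/2⌉-mono )
open import Data.Product as Product using (Σ; ∃-syntax; _×_; _,_; proj₁; proj₂)
import Data.Product.Properties as Product
open import Data.Sum as Sum using (_⊎_; inj₁; inj₂)
import Data.Sum.Properties as Sum
import Data.Vec as Vec
open import Function using (_∘_; case_of_)
open import Function.Bundles using (_⇔_; mk⇔; Equivalence)
open import Function.Construct.Composition using (_⇔-∘_)
open import Relation.Binary.Definitions using (DecidableEquality)
open import Relation.Binary.PropositionalEquality
  using (_≡_; _≢_; refl; sym; trans; cong; cong₂; subst; ≢-sym)
open import Relation.Nullary using (Dec; yes; no; does; ¬_)
open import Relation.Nullary.Decidable using (True; toWitness; _×-dec_; _⊎-dec_; ¬?)

both : ∀ {A B : Set} → (A → B) → A × A → B × B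
both f = Product.map f f

module _ {A : Set} where

  pairUp : List A → List (A × A)
  pairUp (x ∷ y ∷ zs) = (x , y) ∷ pairUp zs
  pairUp _            = []

  unpair : List (A × A) → List A
  unpair []             = []
  unpair ((x , y) ∷ ps) = x ∷ y ∷ unpair ps

  unpair-++ : ∀ ps qs → unpair (ps ++ qs) ≡ unpair ps ++ unpair qs
  unpair-++ []             qs = refl
  unpair-++ ((x , y) ∷ ps) qs = cong (λ zs → x ∷ y ∷ zs) (unpair-++ ps qs)

  unpair-concat : ∀ pss → unpair (concat pss) ≡ concat (map unpair pss)
  unpair-concat []         = refl
  unpair-concat (ps ∷ pss) = trans (unpair-++ ps (concat pss)) (cong (unpair ps ++_) (unpair-concat pss))

  ∈-unpair-pairUp⁻ : ∀ xs {z} → z ∈ unpair (pairUp xs) → z ∈ xs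
  ∈-unpair-pairUp⁻ (x ∷ y ∷ zs) (here refl)         = here refl
  ∈-unpair-pairUp⁻ (x ∷ y ∷ zs) (there (here refl)) = there (here refl)
  ∈-unpair-pairUp⁻ (x ∷ y ∷ zs) (there (there z∈)) = there (there (∈-unpair-pairUp⁻ zs z∈))

  unique-unpair-pairUp : ∀ {xs} → Unique xs → Unique (unpair (pairUp xs))
  unique-unpair-pairUp {[]}         _                       = []
  unique-unpair-pairUp {_ ∷ []}     _                       = []
  unique-unpair-pairUp {x ∷ y ∷ zs} ((x≢y ∷ x∉) ∷ y∉ ∷ u) =
    (x≢y ∷ restrict x∉) ∷ restrict y∉ ∷ unique-unpair-pairUp u
    where
    restrict : ∀ {P : A → Set} → All P zs → All P (unpair (pairUp zs))
    restrict ps = All.tabulate (All.lookup ps ∘ ∈-unpair-pairUp⁻ zs)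

module _ {A B : Set} (f : A → B) where

  pairUp-map : ∀ xs → pairUp (map f xs) ≡ map (both f) (pairUp xs)
  pairUp-map []           = refl
  pairUp-map (_ ∷ [])     = refl
  pairUp-map (x ∷ y ∷ zs) = cong ((f x , f y) ∷_) (pairUp-map zs)

  unpair-map : ∀ ps → unpair (map (both f) ps) ≡ map f (unpair ps)
  unpair-map []             = refl
  unpair-map ((x , y) ∷ ps) = cong (λ zs → f x ∷ f y ∷ zs) (unpair-map ps)

  All-pairUp-map⁻ : ∀ {P : B × B → Set} xs → All P (pairUp (map f xs)) → All (P ∘ both f) (pairUp xs)
  All-pairUp-map⁻ {P} xs = All.map⁻ ∘ subst (All P) (pairUp-map xs)

  unique-map⁺ : ∀ {P : A → Set} → (∀ {x y} → P x → P y → f x ≡ f y → x ≡ y) →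
                ∀ {xs} → All P xs → Unique xs → Unique (map f xs)
  unique-map⁺ inj []         []         = []
  unique-map⁺ inj (px ∷ pxs) (x∉ ∷ u) = separate px pxs x∉ ∷ unique-map⁺ inj pxs u
    where
    separate : ∀ {x ys} → _ → All _ ys → All (x ≢_) ys → All (f x ≢_) (map f ys)
    separate px []         []         = []
    separate px (py ∷ pys) (x≢y ∷ ne) = (x≢y ∘ inj px py) ∷ separate px pys ne

length≡1 : ∀ {A : Set} {xs : List A} → length xs ≡ 1 → ∃[ x ] xs ≡ x ∷ []
length≡1 {xs = x ∷ []} _ = x , refl

length≡2 : ∀ {A : Set} {xs : List A} → length xs ≡ 2 → ∃[ x ] ∃[ y ] xs ≡ x ∷ y ∷ []
length≡2 {xs = x ∷ y ∷ []} _ = x , y , refl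

toList-tabulate : ∀ {A : Set} {k} (f : Fin k → A) → Vec.toList (Vec.tabulate f) ≡ tabulate f
toList-tabulate {k = zero}  f = refl
toList-tabulate {k = suc k} f = cong (f zero ∷_) (toList-tabulate (f ∘ Fin.suc))

record Enumeration (W : Set) : Set where
  field
    elements : List W
    unique   : Unique elements
    complete : ∀ w → w ∈ elements

module _ where
  open Enumeration

  enumFin : ∀ n → Enumeration (Fin n)
  enumFin n = record { elements = allFin n ; unique = Unique.allFin⁺ n ; complete = ∈-allFin }

  enumBool : Enumeration Bool
  enumBool = record
    { elements = true ∷ false ∷ []
    ; unique   = ((λ ()) ∷ []) ∷ [] ∷ []
    ; complete = λ { true → here refl ; false → there (here refl) }
    }

  _×ₑ_ : ∀ {A B : Set} → Enumeration A → Enumeration B → Enumeration (A × B)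
  as ×ₑ bs = record
    { elements = cartesianProduct (elements as) (elements bs)
    ; unique   = Unique.cartesianProduct⁺ (unique as) (unique bs)
    ; complete = λ (a , b) → ∈-cartesianProduct⁺ (complete as a) (complete bs b)
    }

xor-cancelˡ : ∀ a {x y} → a xor x ≡ a xor y → x ≡ y
xor-cancelˡ false eq = eq
xor-cancelˡ true  eq = Bool.not-injective eq

xor-cancelʳ : ∀ a {x y} → x xor a ≡ y xor a → x ≡ y
xor-cancelʳ a {x} {y} eq = xor-cancelˡ a (trans (Bool.xor-comm a x) (trans eq (Bool.xor-comm y a)))

module Orientation {X : Set} (_≟_ : DecidableEquality X) where

  End : Set
  End = X × Bool

  direction : (X → Bool) → End → Bool
  direction o (x , b) = o x xor b

  Splits : (X → Bool) → End × End → Set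
  Splits o (a , a′) = direction o a ≢ direction o a′

  private
    module Contract (e f : X) (e≢f : e ≢ f) (b c : Bool) where

      shift : Bool
      shift = not (b xor c)

      merge : End → End
      merge (g , d) with g ≟ f
      ... | yes _ = (e , shift xor d)
      ... | no _  = (g , d)

      extend : (X → Bool) → X → Bool
      extend o g with g ≟ f
      ... | yes _ = o e xor shift
      ... | no _  = o g

      extend-direction : ∀ o a → direction (extend o) a ≡ direction o (merge a)
      extend-direction o (g , d) with g ≟ f
      ... | yes _ = Bool.xor-assoc (o e) shift d
      ... | no _  = refl

      extend-splits : ∀ o {a a′} → Splits o (merge a , merge a′) → Splits (extend o) (a , a′)
      extend-splits o {a} {a′} s eq =
        s (trans (sym (extend-direction o a)) (trans eq (extend-direction o a′)))

      shift-partner : ∀ d → d ≢ c → shift xor d ≡ b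
      shift-partner d d≢c = partner b c d d≢c
        where
        partner : ∀ x y z → z ≢ y → not (x xor y) xor z ≡ x
        partner false false false z≢y = ⊥-elim (z≢y refl)
        partner false false true  _   = refl
        partner false true  false _   = refl
        partner false true  true  z≢y = ⊥-elim (z≢y refl)
        partner true  false false z≢y = ⊥-elim (z≢y refl)
        partner true  false true  _   = refl
        partner true  true  false _   = refl
        partner true  true  true  z≢y = ⊥-elim (z≢y refl)

      Kept : End → Set
      Kept a = a ≢ (e , b) × a ≢ (f , c)

      -- (f , not c) is sent to the removed end (e , b), so merge is injective on kept ends
      merge-injective : ∀ {a a′} → Kept a → Kept a′ → merge a ≡ merge a′ → a ≡ a′
      merge-injective {g , d} {h , d′} (_ , a≢fc) (a′≢eb , _) eq with g ≟ f | h ≟ f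
      ... | yes refl | yes refl = cong (f ,_) (xor-cancelˡ shift (cong proj₂ eq))
      ... | yes refl | no _     =
        ⊥-elim (a′≢eb (trans (sym eq) (cong (e ,_) (shift-partner d (a≢fc ∘ cong (f ,_))))))
      merge-injective {g , d} {h , d′} (a≢eb , _) (_ , a′≢fc) eq | no _ | yes refl =
        ⊥-elim (a≢eb (trans eq (cong (e ,_) (shift-partner d′ (a′≢fc ∘ cong (f ,_))))))
      merge-injective _ _ eq | no _ | no _ = eq

      head-splits : ∀ o → Splits (extend o) ((e , b) , (f , c))
      head-splits o with e ≟ f | f ≟ f
      ... | yes e≡f | _      = ⊥-elim (e≢f e≡f)
      ... | no _    | no f≢f = ⊥-elim (f≢f refl)
      ... | no _    | yes _  = Bool.not-¬ refl ∘ flip-identity (o e) b c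
        where
        flip-identity : ∀ x y z → x xor y ≡ (x xor not (y xor z)) xor z → x xor y ≡ not (x xor y)
        flip-identity false false false eq = eq
        flip-identity false false true  eq = eq
        flip-identity false true  false eq = eq
        flip-identity false true  true  eq = eq
        flip-identity true  false false eq = eq
        flip-identity true  false true  eq = eq
        flip-identity true  true  false eq = eq
        flip-identity true  true  true  eq = eq

  private
    orient-bounded : ∀ k ps → length ps ≡ k → Unique (unpair ps) → ∃[ o ] All (Splits o) ps
    orient-bounded _       []                            _   _ = (λ _ → false) , []
    orient-bounded (suc k) (((e , b) , (f , c)) ∷ ps) len ((eb≢fc ∷ eb∉) ∷ fc∉ ∷ u) with e ≟ f
    ... | yes refl =
      let o , splits = orient-bounded k ps (cong ℕ.pred len) u
      in  o , (eb≢fc ∘ cong (e ,_) ∘ xor-cancelˡ (o e)) ∷ splits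
    ... | no e≢f =
      let o , splits = orient-bounded k (map (both merge) ps) len′ u′
      in  extend o , head-splits o ∷ All.map (extend-splits o) (All.map⁻ splits)
      where
      open Contract e f e≢f b c
      len′ = trans (length-map (both merge) ps) (cong ℕ.pred len)
      u′ : Unique (unpair (map (both merge) ps))
      u′ = subst Unique (sym (unpair-map merge ps))
             (unique-map⁺ merge merge-injective (All.zip (All.map ≢-sym eb∉ , All.map ≢-sym fc∉)) u)

  orient : ∀ ps → Unique (unpair ps) → ∃[ o ] All (Splits o) ps
  orient ps = orient-bounded (length ps) ps refl

  module _ {W : Set} (sites : Enumeration W) (ends : W → List End)
           (unique-ends : ∀ w → Unique (ends w))
           (site : End → W) (site-ends : ∀ w {a} → a ∈ ends w → site a ≡ w) where

    open Enumeration sites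

    private
      pairs : List (End × End)
      pairs = concatMap (pairUp ∘ ends) elements

      separated : ∀ {w w′} → w ≢ w′ → Disjoint (unpair (pairUp (ends w))) (unpair (pairUp (ends w′)))
      separated {w} {w′} w≢w′ (a∈ , a∈′) =
        w≢w′ (trans (sym (site-ends w (∈-unpair-pairUp⁻ (ends w) a∈)))
                    (site-ends w′ (∈-unpair-pairUp⁻ (ends w′) a∈′)))

      unique-pairs : Unique (unpair pairs)
      unique-pairs = subst Unique (sym (unpair-concat (map (pairUp ∘ ends) elements)))
        (Unique.concat⁺
          (All.map⁺ (All.map⁺ (All.universal (unique-unpair-pairUp ∘ unique-ends) elements)))
          (AllPairs.map⁺ (AllPairs.map⁺ (AllPairs.map separated unique))))

    orientSites : ∃[ o ] ∀ w → All (Splits o) (pairUp (ends w))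
    orientSites =
      let o , splits = orient pairs unique-pairs
      in  o , λ w → All.lookup (All.map⁻ (All.concat⁻ splits)) (complete w)

module _ {A : Set} (g : A → Bool) where

  Separated : A × A → Set
  Separated (x , y) = g x ≢ g y

  count : Bool → List A → ℕ
  count b = length ∘ filter (λ x → g x Bool.≟ b)

  count-true+false : ∀ xs → count true xs + count false xs ≡ length xs
  count-true+false []       = refl
  count-true+false (x ∷ xs) with g x
  ... | true  = cong suc (count-true+false xs)
  ... | false = trans (+-suc (count true xs) (count false xs)) (cong suc (count-true+false xs))

  count-separated-pair : ∀ {x y} zs → g x ≢ g y → ∀ b → count b (x ∷ y ∷ zs) ≡ suc (count b zs)
  count-separated-pair {x} {y} zs gx≢gy b with g x | b
  ... | true  | true  with g y
  ...   | true  = ⊥-elim (gx≢gy refl)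
  ...   | false = refl
  count-separated-pair {x} {y} zs gx≢gy b | true  | false with g y
  ...   | true  = ⊥-elim (gx≢gy refl)
  ...   | false = refl
  count-separated-pair {x} {y} zs gx≢gy b | false | true  with g y
  ...   | true  = refl
  ...   | false = ⊥-elim (gx≢gy refl)
  count-separated-pair {x} {y} zs gx≢gy b | false | false with g y
  ...   | true  = refl
  ...   | false = ⊥-elim (gx≢gy refl)

  count-≤-half : ∀ xs → All Separated (pairUp xs) → ∀ b → count b xs ≤ ⌈ length xs /2⌉
  count-≤-half []           _        b = z≤n
  count-≤-half (x ∷ [])     _        b = length-filter (λ x → g x Bool.≟ b) (x ∷ [])
  count-≤-half (x ∷ y ∷ zs) (s ∷ ss) b =
    subst (_≤ _) (sym (count-separated-pair zs s b)) (s≤s (count-≤-half zs ss b))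

  separated-in-pair : ∀ {xs} → length xs ≤ 2 → All Separated (pairUp xs) →
                      ∀ {x y} → x ∈ xs → y ∈ xs → x ≢ y → g x ≢ g y
  separated-in-pair {_ ∷ []}     _ _ (here refl) (here refl) x≢y = ⊥-elim (x≢y refl)
  separated-in-pair {_ ∷ _ ∷ []} _ _ (here refl) (here refl) x≢y = ⊥-elim (x≢y refl)
  separated-in-pair {_ ∷ _ ∷ []} _ (s ∷ []) (here refl) (there (here refl)) _ = s
  separated-in-pair {_ ∷ _ ∷ []} _ (s ∷ []) (there (here refl)) (here refl) _ = s ∘ sym
  separated-in-pair {_ ∷ _ ∷ []} _ _ (there (here refl)) (there (here refl)) x≢y = ⊥-elim (x≢y refl)
  separated-in-pair {_ ∷ _ ∷ _ ∷ _} (s≤s (s≤s ()))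

  -- three Booleans cannot be pairwise distinct
  separating-list-≤2 : ∀ {xs} → Unique xs → (∀ {x y} → x ∈ xs → y ∈ xs → x ≢ y → g x ≢ g y) → length xs ≤ 2
  separating-list-≤2 {[]}         _ _ = z≤n
  separating-list-≤2 {_ ∷ []}     _ _ = s≤s z≤n
  separating-list-≤2 {_ ∷ _ ∷ []} _ _ = s≤s (s≤s z≤n)
  separating-list-≤2 {x ∷ y ∷ z ∷ _} ((x≢y ∷ x≢z ∷ _) ∷ (y≢z ∷ _) ∷ _) sep =
    ⊥-elim (no-three (g x) (g y) (g z) (sep x∈ y∈ x≢y) (sep x∈ z∈ x≢z) (sep y∈ z∈ y≢z))
    where
    x∈ = here refl
    y∈ = there (here refl)
    z∈ = there (there (here refl))
    no-three : ∀ a b c → a ≢ b → a ≢ c → b ≢ c → _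
    no-three false false _     a≢b _   _   = a≢b refl
    no-three true  true  _     a≢b _   _   = a≢b refl
    no-three false true  false _   a≢c _   = a≢c refl
    no-three true  false true  _   a≢c _   = a≢c refl
    no-three false true  true  _   _   b≢c = b≢c refl
    no-three true  false false _   _   b≢c = b≢c refl

  pair-covers : ∀ {xs} → length xs ≡ 2 → All Separated (pairUp xs) → ∀ b → ∃[ x ] (x ∈ xs × g x ≡ b)
  pair-covers {x ∷ y ∷ []} _ (gx≢gy ∷ []) b with g x Bool.≟ b
  ... | yes gx≡b = x , here refl , gx≡b
  ... | no gx≢b  = y , there (here refl) ,
                   trans (Bool.¬-not (gx≢gy ∘ sym)) (sym (Bool.¬-not (gx≢b ∘ sym)))

halves-of-even : ∀ {a b j} → a ≤ j → b ≤ j → a + b ≡ j + j → a ≡ j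
halves-of-even {a} {b} {j} a≤j b≤j sum =
  ≤-antisym a≤j (+-cancelʳ-≤ j j a (subst (_≤ a + j) sum (+-monoʳ-≤ a b≤j)))

halves-of-odd : ∀ {a b j} → a ≤ suc j → b ≤ suc j → a + b ≡ suc (j + j) →
                (a ≡ suc j × b ≡ j) ⊎ (a ≡ j × b ≡ suc j)
halves-of-odd {a} {b} {j} a≤ b≤ sum with a ℕ.≟ suc j
... | yes refl = inj₁ (refl , +-cancelˡ-≡ (suc j) b j sum)
... | no a≢   = inj₂ (a≡j , b≡)
  where
  a≤j : a ≤ j
  a≤j = ≤-pred (≤∧≢⇒< a≤ a≢)
  b≡ : b ≡ suc j
  b≡ = ≤-antisym b≤ (+-cancelˡ-≤ j (suc j) b
         (subst (_≤ j + b) (trans sum (sym (+-suc j j))) (+-monoˡ-≤ b a≤j)))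
  a≡j : a ≡ j
  a≡j = +-cancelʳ-≡ b a j (trans sum (trans (sym (+-suc j j)) (cong (j +_) (sym b≡))))

Class : Set
Class = Bool × Bool

_≟ᶜ_ : (k k′ : Class) → Dec (k ≡ k′)
_≟ᶜ_ = Product.≡-dec Bool._≟_ Bool._≟_

colour : Bool → Class → ℕ
colour false (false , false) = 1
colour true  (false , false) = 2
colour false (true  , false) = 3
colour true  (true  , false) = 4
colour false (false , true ) = 5
colour true  (false , true ) = 6
colour false (true  , true ) = 7
colour true  (true  , true ) = 8

bitOf : ℕ → Bool
bitOf 2 = true
bitOf 4 = true
bitOf 6 = true
bitOf 8 = true
bitOf _ = false

classOf : ℕ → Class
classOf 3 = (true  , false)
classOf 4 = (true  , false)
classOf 5 = (false , true )
classOf 6 = (false , true )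
classOf 7 = (true  , true )
classOf 8 = (true  , true )
classOf _ = (false , false)

InRange : ℕ → Set
InRange c = 1 ≤ c × c ≤ 8

inRange? : ∀ c → Dec (InRange c)
inRange? c = (1 ≤? c) ×-dec (c ≤? 8)

colour-inRange : ∀ b k → InRange (colour b k)
colour-inRange false (false , false) = s≤s z≤n , s≤s z≤n
colour-inRange true  (false , false) = s≤s z≤n , s≤s (s≤s z≤n)
colour-inRange false (true  , false) = s≤s z≤n , s≤s (s≤s (s≤s z≤n))
colour-inRange true  (true  , false) = s≤s z≤n , s≤s (s≤s (s≤s (s≤s z≤n)))
colour-inRange false (false , true ) = s≤s z≤n , s≤s (s≤s (s≤s (s≤s (s≤s z≤n))))
colour-inRange true  (false , true ) = s≤s z≤n , s≤s (s≤s (s≤s (s≤s (s≤s (s≤s z≤n)))))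
colour-inRange false (true  , true ) = s≤s z≤n , s≤s (s≤s (s≤s (s≤s (s≤s (s≤s (s≤s z≤n))))))
colour-inRange true  (true  , true ) = s≤s z≤n , s≤s (s≤s (s≤s (s≤s (s≤s (s≤s (s≤s (s≤s z≤n)))))))

decode-colour : ∀ b k → bitOf (colour b k) ≡ b × classOf (colour b k) ≡ k
decode-colour false (false , false) = refl , refl
decode-colour true  (false , false) = refl , refl
decode-colour false (true  , false) = refl , refl
decode-colour true  (true  , false) = refl , refl
decode-colour false (false , true ) = refl , refl
decode-colour true  (false , true ) = refl , refl
decode-colour false (true  , true ) = refl , refl
decode-colour true  (true  , true ) = refl , refl

colour-decode : ∀ {c} → InRange c → colour (bitOf c) (classOf c) ≡ c
colour-decode {1} _ = refl
colour-decode {2} _ = refl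
colour-decode {3} _ = refl
colour-decode {4} _ = refl
colour-decode {5} _ = refl
colour-decode {6} _ = refl
colour-decode {7} _ = refl
colour-decode {8} _ = refl
colour-decode {0} (() , _)
colour-decode {suc (suc (suc (suc (suc (suc (suc (suc (suc _))))))))}
  (_ , s≤s (s≤s (s≤s (s≤s (s≤s (s≤s (s≤s (s≤s ()))))))))

colour-injective : ∀ {b b′ k k′} → colour b k ≡ colour b′ k′ → b ≡ b′ × k ≡ k′
colour-injective {b} {b′} {k} {k′} eq =
  trans (sym (proj₁ (decode-colour b k))) (trans (cong bitOf eq) (proj₁ (decode-colour b′ k′))) ,
  trans (sym (proj₂ (decode-colour b k))) (trans (cong classOf eq) (proj₂ (decode-colour b′ k′)))

Consecutive-resp-⇔ : ∀ {S T : ℕ → Set} → (∀ c → S c ⇔ T c) → Consecutive T → Consecutive S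
Consecutive-resp-⇔ S⇔T (a , b , T⇔) = a , b , λ c → T⇔ c ⇔-∘ S⇔T c

Complement : (ℕ → Set) → ℕ → Set
Complement S c = InRange c × ¬ S c

Complement-resp-⇔ : ∀ {S T : ℕ → Set} → (∀ c → S c ⇔ T c) → ∀ c → Complement S c ⇔ Complement T c
Complement-resp-⇔ S⇔T c = mk⇔
  (λ (r , ¬s) → r , ¬s ∘ Equivalence.from (S⇔T c))
  (λ (r , ¬t) → r , ¬t ∘ Equivalence.to (S⇔T c))

singleton-consecutive : ∀ {S : ℕ → Set} a → (∀ c → S c ⇔ c ≡ a) → Consecutive S
singleton-consecutive a S⇔ = a , a , λ c → mk⇔
  (λ s → let c≡a = Equivalence.to (S⇔ c) s in
         subst (λ x → a ≤ x × x ≤ a) (sym c≡a) (≤-refl , ≤-refl))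
  (λ (a≤c , c≤a) → Equivalence.from (S⇔ c) (≤-antisym c≤a a≤c))

private
  does-≡⇒⇔ : ∀ {P Q : Set} (P? : Dec P) (Q? : Dec Q) → does P? ≡ does Q? → P ⇔ Q
  does-≡⇒⇔ (yes p)  (yes q)  _ = mk⇔ (λ _ → q) (λ _ → p)
  does-≡⇒⇔ (no ¬p) (no ¬q) _ = mk⇔ (⊥-elim ∘ ¬p) (⊥-elim ∘ ¬q)

  interval? : ∀ a b c → Dec (a ≤ c × c ≤ b)
  interval? a b c = (a ≤? c) ×-dec (c ≤? b)

  agrees? : ∀ {S : ℕ → Set} (S? : ∀ c → Dec (S c)) a b →
            Dec (∀ (i : Fin 9) → does (S? (toℕ i)) ≡ does (interval? a b (toℕ i)))
  agrees? S? a b = Fin.all? (λ i → does (S? (toℕ i)) Bool.≟ does (interval? a b (toℕ i)))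

  -- a set of colours is the interval [a, b] once the two agree on {0, …, 8}, which is decidable
  consecutive-by-checking : ∀ {P : ℕ → Set} (P? : ∀ c → Dec (P c)) a b →
    let S? = λ c → inRange? c ×-dec P? c in
    True (b ≤? 8) → True (agrees? S? a b) → Consecutive (λ c → InRange c × P c)
  consecutive-by-checking {P} P? a b b≤8 check = a , b , agree
    where
    agree : ∀ c → (InRange c × P c) ⇔ (a ≤ c × c ≤ b)
    agree c with c ≤? 8
    ... | yes c≤8 = subst (λ x → (InRange x × P x) ⇔ (a ≤ x × x ≤ b)) (Fin.toℕ-fromℕ< (s≤s c≤8))
                      (does-≡⇒⇔ (inRange? _ ×-dec P? _) (interval? a b _) (toWitness check (fromℕ< (s≤s c≤8))))
    ... | no c≰8  = mk⇔ (λ ((_ , c≤8) , _) → ⊥-elim (c≰8 c≤8))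
                        (λ (_ , c≤b) → ⊥-elim (c≰8 (≤-trans c≤b (toWitness b≤8))))

ColoursOf : (Class → Set) → ℕ → Set
ColoursOf K c = InRange c × K (classOf c)

single-class-consecutive : ∀ k → Consecutive (ColoursOf (_≡ k))
single-class-consecutive k@(false , false) = consecutive-by-checking (λ c → classOf c ≟ᶜ k) 1 2 _ _
single-class-consecutive k@(true  , false) = consecutive-by-checking (λ c → classOf c ≟ᶜ k) 3 4 _ _
single-class-consecutive k@(false , true ) = consecutive-by-checking (λ c → classOf c ≟ᶜ k) 5 6 _ _
single-class-consecutive k@(true  , true ) = consecutive-by-checking (λ c → classOf c ≟ᶜ k) 7 8 _ _

TwoClasses : Class → Class → Class → Set
TwoClasses k₁ k₂ k = k ≡ k₁ ⊎ k ≡ k₂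

private
  two? : ∀ k₁ k₂ c → Dec (TwoClasses k₁ k₂ (classOf c))
  two? k₁ k₂ c = (classOf c ≟ᶜ k₁) ⊎-dec (classOf c ≟ᶜ k₂)

  ¬two? : ∀ k₁ k₂ c → Dec (¬ ColoursOf (TwoClasses k₁ k₂) c)
  ¬two? k₁ k₂ c = ¬? (inRange? c ×-dec two? k₁ k₂ c)

-- classes differing in their first bit are cyclically adjacent among the four blocks of two colours
two-classes-consecutive : ∀ k₁ k₂ → proj₁ k₁ ≢ proj₁ k₂ →
  Consecutive (ColoursOf (TwoClasses k₁ k₂)) ⊎ Consecutive (Complement (ColoursOf (TwoClasses k₁ k₂)))
two-classes-consecutive k₁@(false , false) k₂@(true  , false) _ = inj₁ (consecutive-by-checking (two? k₁ k₂) 1 4 _ _)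
two-classes-consecutive k₁@(true  , false) k₂@(false , false) _ = inj₁ (consecutive-by-checking (two? k₁ k₂) 1 4 _ _)
two-classes-consecutive k₁@(true  , false) k₂@(false , true ) _ = inj₁ (consecutive-by-checking (two? k₁ k₂) 3 6 _ _)
two-classes-consecutive k₁@(false , true ) k₂@(true  , false) _ = inj₁ (consecutive-by-checking (two? k₁ k₂) 3 6 _ _)
two-classes-consecutive k₁@(false , true ) k₂@(true  , true ) _ = inj₁ (consecutive-by-checking (two? k₁ k₂) 5 8 _ _)
two-classes-consecutive k₁@(true  , true ) k₂@(false , true ) _ = inj₁ (consecutive-by-checking (two? k₁ k₂) 5 8 _ _)
two-classes-consecutive k₁@(false , false) k₂@(true  , true ) _ = inj₂ (consecutive-by-checking (¬two? k₁ k₂) 3 6 _ _)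
two-classes-consecutive k₁@(true  , true ) k₂@(false , false) _ = inj₂ (consecutive-by-checking (¬two? k₁ k₂) 3 6 _ _)
two-classes-consecutive (false , _) (false , _) x≢x = ⊥-elim (x≢x refl)
two-classes-consecutive (true  , _) (true  , _) x≢x = ⊥-elim (x≢x refl)

ColoursOf-resp-⇔ : ∀ {K L : Class → Set} → (∀ k → K k ⇔ L k) → ∀ c → ColoursOf K c ⇔ ColoursOf L c
ColoursOf-resp-⇔ K⇔L c = mk⇔ (λ (r , k) → r , Equivalence.to (K⇔L _) k) (λ (r , l) → r , Equivalence.from (K⇔L _) l)

complement-of-others : ∀ k c → Complement (ColoursOf (_≢ k)) c ⇔ ColoursOf (_≡ k) c
complement-of-others k c = mk⇔ to (λ (r , c-k) → r , λ (_ , c≢k) → c≢k c-k)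
  where
  to : Complement (ColoursOf (_≢ k)) c → ColoursOf (_≡ k) c
  to (r , not-other) with classOf c ≟ᶜ k
  ... | yes c-k = r , c-k
  ... | no c≢k  = ⊥-elim (not-other (r , c≢k))

AllowedDegree : ℕ → Set
AllowedDegree d = (d ≡ 1) ⊎ (d ≡ 2) ⊎ (d ≡ 4) ⊎ (d ≡ 6) ⊎ (d ≡ 7) ⊎ (d ≡ 8)

⌈n+n/2⌉≡n : ∀ n → ⌈ n + n /2⌉ ≡ n
⌈n+n/2⌉≡n zero    = refl
⌈n+n/2⌉≡n (suc n) = cong suc (trans (cong ⌊_/2⌋ (+-suc n n)) (⌈n+n/2⌉≡n n))

⌈1+n+n/2⌉≡1+n : ∀ n → ⌈ suc (n + n) /2⌉ ≡ suc n
⌈1+n+n/2⌉≡1+n n = cong suc (sym (n≡⌊n+n/2⌋ n))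

-- each side of a vertex of even degree 2j gets 4 − j virtual slots, so that it has exactly four
paddingSize : ℕ → ℕ
paddingSize 2 = 3
paddingSize 4 = 2
paddingSize 6 = 1
paddingSize _ = 0

padding : ℕ → List (Fin 3)
padding d = take (paddingSize d) (allFin 3)

fits-in-four : ∀ {d} → AllowedDegree d → ⌈ d /2⌉ + length (padding d) ≤ 4
fits-in-four (inj₁ refl)                               = s≤s z≤n
fits-in-four (inj₂ (inj₁ refl))                        = ≤-refl
fits-in-four (inj₂ (inj₂ (inj₁ refl)))                 = ≤-refl
fits-in-four (inj₂ (inj₂ (inj₂ (inj₁ refl))))          = ≤-refl
fits-in-four (inj₂ (inj₂ (inj₂ (inj₂ (inj₁ refl)))))   = ≤-refl
fits-in-four (inj₂ (inj₂ (inj₂ (inj₂ (inj₂ refl)))))   = ≤-refl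

module Construction (G : Graph) (side : Fin (n G) → Bool)
  (bipartite : ∀ e → side (proj₁ (ends G e)) ≢ side (proj₂ (ends G e)))
  (allowed : ∀ v → AllowedDegree (degree G v)) where

  Vertex Edge : Set
  Vertex = Fin (n G)
  Edge   = Fin (m G)

  vertices : Enumeration Vertex
  vertices = enumFin (n G)

  edges : List Edge
  edges = Vec.toList (Vec.allFin (m G))

  incident : Vertex → List Edge
  incident v = filter (λ e → incident? G e v) edges

  unique-incident : ∀ v → Unique (incident v)
  unique-incident v = Unique.filter⁺ (λ e → incident? G e v)
    (subst Unique (sym (toList-tabulate (λ e → e))) (Unique.allFin⁺ (m G)))

  incident⁺ : ∀ {e v} → Incident G e v → e ∈ incident v
  incident⁺ {e} {v} = ∈-filter⁺ (λ e → incident? G e v)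
    (subst (e ∈_) (sym (toList-tabulate (λ e → e))) (∈-allFin e))

  incident⁻ : ∀ {e v} → e ∈ incident v → Incident G e v
  incident⁻ {v = v} = proj₂ ∘ ∈-filter⁻ (λ e → incident? G e v) {xs = edges}

  first second : Edge → Vertex
  first  = proj₁ ∘ ends G
  second = proj₂ ∘ ends G

  endpoint : Edge × Bool → Vertex
  endpoint (e , false) = first e
  endpoint (e , true)  = second e

  isSecond : Edge → Vertex → Bool
  isSecond e v = not (does (first e Fin.≟ v))

  endAt : Vertex → Edge → Edge × Bool
  endAt v e = (e , isSecond e v)

  endpoint-endAt : ∀ {e v} → e ∈ incident v → endpoint (endAt v e) ≡ v
  endpoint-endAt {e} {v} e∈ with first e Fin.≟ v | incident⁻ e∈
  ... | yes first≡v | _                 = first≡v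
  ... | no first≢v  | inj₁ first≡v      = ⊥-elim (first≢v first≡v)
  ... | no _        | inj₂ second≡v     = second≡v

  module EdgeEnds = Orientation (Fin._≟_ {m G})

  edgeEnds-at : ∀ v {a} → a ∈ map (endAt v) (incident v) → endpoint a ≡ v
  edgeEnds-at v a∈ with ∈-map⁻ (endAt v) a∈
  ... | e , e∈ , refl = endpoint-endAt e∈

  unique-edgeEnds : ∀ v {es} → Unique es → Unique (map (endAt v) es)
  unique-edgeEnds v = Unique.map⁺ (cong proj₁)

  abstract
    balancedOrientation : ∃[ o ] ∀ v → All (EdgeEnds.Splits o) (pairUp (map (endAt v) (incident v)))
    balancedOrientation = EdgeEnds.orientSites vertices (λ v → map (endAt v) (incident v))
                            (λ v → unique-edgeEnds v (unique-incident v)) endpoint edgeEnds-at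

  orientation : Edge → Bool
  orientation = proj₁ balancedOrientation

  outAt : Vertex → Edge → Bool
  outAt v e = orientation e xor isSecond e v

  outAt-balanced : ∀ v → All (Separated (outAt v)) (pairUp (incident v))
  outAt-balanced v = All-pairUp-map⁻ (endAt v) (incident v) (proj₂ balancedOrientation v)

  out : Vertex → Bool → List Edge
  out v β = filter (λ e → outAt v e Bool.≟ β) (incident v)

  out⁺ : ∀ {e v} → e ∈ incident v → e ∈ out v (outAt v e)
  out⁺ e∈ = ∈-filter⁺ (λ e → _ Bool.≟ _) e∈ refl

  out⁻ : ∀ {e v β} → e ∈ out v β → e ∈ incident v × outAt v e ≡ β
  out⁻ {v = v} {β} = ∈-filter⁻ (λ e → outAt v e Bool.≟ β) {xs = incident v}

  out-opposite : ∀ {e f v β} → e ∈ out v β → f ∈ out v (not β) → e ≢ f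
  out-opposite e∈ f∈ refl = Bool.not-¬ (proj₂ (out⁻ e∈)) (proj₂ (out⁻ f∈))

  out-total : ∀ v → length (out v true) + length (out v false) ≡ degree G v
  out-total v = count-true+false (outAt v) (incident v)

  out-≤-half : ∀ v β → length (out v β) ≤ ⌈ degree G v /2⌉
  out-≤-half v = count-≤-half (outAt v) (incident v) (outAt-balanced v)

  out-even : ∀ {v j} → degree G v ≡ j + j → ∀ β → length (out v β) ≡ j
  out-even {v} {j} deg≡ β = halves-of-even (bound β) (bound (not β)) (total β)
    where
    bound : ∀ β → length (out v β) ≤ j
    bound β = subst (length (out v β) ≤_) (trans (cong ⌈_/2⌉ deg≡) (⌈n+n/2⌉≡n j)) (out-≤-half v β)
    total : ∀ β → length (out v β) + length (out v (not β)) ≡ j + j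
    total true  = trans (out-total v) deg≡
    total false = trans (+-comm (length (out v false)) _) (trans (out-total v) deg≡)

  out-odd : ∀ {v j} → degree G v ≡ suc (j + j) →
            ∃[ β ] (length (out v β) ≡ suc j × length (out v (not β)) ≡ j)
  out-odd {v} {j} deg≡ with halves-of-odd (bound true) (bound false) (trans (out-total v) deg≡)
    where
    bound : ∀ β → length (out v β) ≤ suc j
    bound β = subst (length (out v β) ≤_) (trans (cong ⌈_/2⌉ deg≡) (⌈1+n+n/2⌉≡1+n j)) (out-≤-half v β)
  ... | inj₁ lengths = true , lengths
  ... | inj₂ (f≡ , t≡) = false , t≡ , f≡

  -- the endpoint at which e is an out-edge (β = true) or an in-edge (β = false)
  endpointWith : Edge → Bool → Vertex
  endpointWith e β = endpoint (e , orientation e xor β)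

  endpointWith-outAt : ∀ {e v} → e ∈ incident v → endpointWith e (outAt v e) ≡ v
  endpointWith-outAt {e} {v} e∈ =
    trans (cong (λ b → endpoint (e , b)) (cancel (orientation e) (isSecond e v))) (endpoint-endAt e∈)
    where
    cancel : ∀ x y → x xor (x xor y) ≡ y
    cancel false y = refl
    cancel true  y = Bool.not-involutive y

  Slot : Set
  Slot = Edge ⊎ (Vertex × Fin 3)

  virtual : Vertex → List Slot
  virtual v = map (λ j → inj₂ (v , j)) (padding (degree G v))

  slots : Vertex → Bool → List Slot
  slots v β = map inj₁ (out v β) ++ virtual v

  edge-slot : ∀ {e v β} → e ∈ out v β → inj₁ e ∈ slots v β
  edge-slot = ∈-++⁺ˡ ∘ ∈-map⁺ inj₁

  virtual-slot : ∀ {x v} β → x ∈ virtual v → x ∈ slots v β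
  virtual-slot {v = v} β = ∈-++⁺ʳ (map inj₁ (out v β))

  virtual-not-edge : ∀ {x v e} → x ∈ virtual v → x ≢ inj₁ e
  virtual-not-edge x∈ with ∈-map⁻ _ x∈
  ... | _ , _ , refl = λ ()

  slot-cases : ∀ {x v β} → x ∈ slots v β → (∃[ e ] (e ∈ out v β × x ≡ inj₁ e)) ⊎ x ∈ virtual v
  slot-cases {v = v} {β} x∈ with ∈-++⁻ (map inj₁ (out v β)) x∈
  ... | inj₁ x∈edges = inj₁ (∈-map⁻ inj₁ x∈edges)
  ... | inj₂ x∈virtual = inj₂ x∈virtual

  unique-slots : ∀ v β → Unique (slots v β)
  unique-slots v β = Unique.++⁺
    (Unique.map⁺ (λ { refl → refl }) (Unique.filter⁺ _ (unique-incident v)))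
    (Unique.map⁺ (λ { refl → refl }) (Unique.take⁺ (paddingSize (degree G v)) (Unique.allFin⁺ 3)))
    (λ (x∈edges , x∈virtual) → virtual-not-edge x∈virtual (proj₂ (proj₂ (∈-map⁻ inj₁ x∈edges))))

  slots-length : ∀ v β → length (slots v β) ≡ length (out v β) + length (padding (degree G v))
  slots-length v β = trans (length-++ (map inj₁ (out v β)))
                           (cong₂ _+_ (length-map inj₁ (out v β)) (length-map _ (padding (degree G v))))

  slots-≤4 : ∀ v β → length (slots v β) ≤ 4
  slots-≤4 v β = ≤-trans (≤-reflexive (slots-length v β))
                   (≤-trans (+-monoˡ-≤ _ (out-≤-half v β)) (fits-in-four (allowed v)))

  module SlotEnds = Orientation (Sum.≡-dec (Fin._≟_ {m G}) (Product.≡-dec (Fin._≟_ {n G}) (Fin._≟_ {3})))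

  -- a slot with tag β sits at the vertex where it is on side β
  slotSite : Slot × Bool → Vertex × Bool
  slotSite (inj₁ e , β)       = endpointWith e β , β
  slotSite (inj₂ (v , _) , β) = v , β

  taggedSlots : Vertex × Bool → List (Slot × Bool)
  taggedSlots (v , β) = map (_, β) (slots v β)

  slotSite-slot : ∀ {v β x} → x ∈ slots v β → slotSite (x , β) ≡ (v , β)
  slotSite-slot x∈ with slot-cases x∈
  ... | inj₁ (e , e∈ , refl) =
    cong (_, _) (trans (cong (endpointWith e) (sym (proj₂ (out⁻ e∈)))) (endpointWith-outAt (proj₁ (out⁻ e∈))))
  ... | inj₂ x∈virtual with ∈-map⁻ _ x∈virtual
  ...   | _ , _ , refl = refl

  slotSite-at : ∀ vβ {a} → a ∈ taggedSlots vβ → slotSite a ≡ vβ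
  slotSite-at (v , β) a∈ with ∈-map⁻ (_, β) a∈
  ... | x , x∈ , refl = slotSite-slot x∈

  unique-taggedSlots : ∀ vβ → Unique (taggedSlots vβ)
  unique-taggedSlots (v , β) = Unique.map⁺ (cong proj₁) (unique-slots v β)

  separated-by-tag : ∀ {o : Slot → Bool} β xs →
                     All (SlotEnds.Splits o) (pairUp (map (_, β) xs)) → All (Separated o) (pairUp xs)
  separated-by-tag β xs splits =
    All.map (λ s eq → s (cong (_xor β) eq)) (All-pairUp-map⁻ (_, β) xs splits)

  abstract
    balancedFirstBit : ∃[ o ] ∀ vβ → All (SlotEnds.Splits o) (pairUp (taggedSlots vβ))
    balancedFirstBit = SlotEnds.orientSites (vertices ×ₑ enumBool) taggedSlots unique-taggedSlots slotSite slotSite-at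

  firstBit : Slot → Bool
  firstBit = proj₁ balancedFirstBit

  firstBit-separates : ∀ v β → All (Separated firstBit) (pairUp (slots v β))
  firstBit-separates v β = separated-by-tag β (slots v β) (proj₂ balancedFirstBit (v , β))

  halfSlots : Vertex → Bool → Bool → List Slot
  halfSlots v β a = filter (λ x → firstBit x Bool.≟ a) (slots v β)

  halfSlots⁻ : ∀ {v β a x} → x ∈ halfSlots v β a → x ∈ slots v β × firstBit x ≡ a
  halfSlots⁻ {v} {β} {a} = ∈-filter⁻ (λ x → firstBit x Bool.≟ a) {xs = slots v β}

  halfSlots⁺ : ∀ {v β x} → x ∈ slots v β → x ∈ halfSlots v β (firstBit x)
  halfSlots⁺ x∈ = ∈-filter⁺ (λ x → _ Bool.≟ _) x∈ refl

  taggedHalves : (Vertex × Bool) × Bool → List (Slot × Bool)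
  taggedHalves ((v , β) , a) = map (_, β) (halfSlots v β a)

  halfSite : Slot × Bool → (Vertex × Bool) × Bool
  halfSite (x , β) = slotSite (x , β) , firstBit x

  halfSite-at : ∀ vβa {a} → a ∈ taggedHalves vβa → halfSite a ≡ vβa
  halfSite-at ((v , β) , a) a∈ with ∈-map⁻ (_, β) a∈
  ... | x , x∈ , refl = let x∈slots , bit≡ = halfSlots⁻ x∈ in cong₂ _,_ (slotSite-slot x∈slots) bit≡

  unique-taggedHalves : ∀ vβa → Unique (taggedHalves vβa)
  unique-taggedHalves ((v , β) , a) = Unique.map⁺ (cong proj₁) (Unique.filter⁺ _ (unique-slots v β))

  abstract
    balancedSecondBit : ∃[ o ] ∀ vβa → All (SlotEnds.Splits o) (pairUp (taggedHalves vβa))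
    balancedSecondBit = SlotEnds.orientSites ((vertices ×ₑ enumBool) ×ₑ enumBool) taggedHalves
                          unique-taggedHalves halfSite halfSite-at

  secondBit : Slot → Bool
  secondBit = proj₁ balancedSecondBit

  secondBit-separates : ∀ v β a → All (Separated secondBit) (pairUp (halfSlots v β a))
  secondBit-separates v β a = separated-by-tag β (halfSlots v β a) (proj₂ balancedSecondBit ((v , β) , a))

  class : Slot → Class
  class x = firstBit x , secondBit x

  halfSlots-≤2 : ∀ v β a → length (halfSlots v β a) ≤ 2
  halfSlots-≤2 v β a = ≤-trans (count-≤-half firstBit (slots v β) (firstBit-separates v β) a)
                               (⌈n/2⌉-mono (slots-≤4 v β))

  halfSlots-total : ∀ v β a → length (halfSlots v β a) + length (halfSlots v β (not a)) ≡ length (slots v β)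
  halfSlots-total v β true  = count-true+false firstBit (slots v β)
  halfSlots-total v β false = trans (+-comm (length (halfSlots v β false)) _) (count-true+false firstBit (slots v β))

  slot-classes-distinct : ∀ {v β x y} → x ∈ slots v β → y ∈ slots v β → x ≢ y → class x ≢ class y
  slot-classes-distinct {v} {β} {x} {y} x∈ y∈ x≢y with firstBit x Bool.≟ firstBit y
  ... | no first≢  = first≢ ∘ cong proj₁
  ... | yes first≡ = separated-in-pair secondBit (halfSlots-≤2 v β (firstBit x)) (secondBit-separates v β (firstBit x))
                       (halfSlots⁺ x∈) (subst (λ a → y ∈ halfSlots v β a) (sym first≡) (halfSlots⁺ y∈)) x≢y
                     ∘ cong proj₂

  ClassIn : List Slot → Class → Set
  ClassIn xs k = ∃[ x ] (x ∈ xs × class x ≡ k)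

  halfSlots-covers : ∀ {v β a} → length (halfSlots v β a) ≡ 2 → ∀ b → ClassIn (slots v β) (a , b)
  halfSlots-covers {v} {β} {a} two b =
    let x , x∈ , second≡ = pair-covers secondBit two (secondBit-separates v β a) b
        x∈slots , first≡ = halfSlots⁻ x∈
    in  x , x∈slots , cong₂ _,_ first≡ second≡

  slots-cover : ∀ {v β} → length (slots v β) ≡ 4 → ∀ k → ClassIn (slots v β) k
  slots-cover {v} {β} four (a , b) = halfSlots-covers (halves-of-even (halfSlots-≤2 v β a) (halfSlots-≤2 v β (not a))
                                                       (trans (halfSlots-total v β a) four)) b

  lone-half : ∀ {v β} → length (slots v β) ≡ 3 →
              ∃[ a ] (length (halfSlots v β a) ≡ 1 × length (halfSlots v β (not a)) ≡ 2)
  lone-half {v} {β} three with halves-of-odd (halfSlots-≤2 v β true) (halfSlots-≤2 v β false)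
                                             (trans (halfSlots-total v β true) three)
  ... | inj₁ (true≡2 , false≡1) = false , false≡1 , true≡2
  ... | inj₂ (true≡1 , false≡2) = true , true≡1 , false≡2

  slots-miss-one : ∀ {v β} → length (slots v β) ≡ 3 → ∃[ k* ] ∀ k → ClassIn (slots v β) k ⇔ k ≢ k*
  slots-miss-one {v} {β} three with lone-half three
  ... | a , one , two with length≡1 one
  ...   | z , lone = (a , not (secondBit z)) , λ k → mk⇔ missing (present k)
    where
    z∈ : z ∈ halfSlots v β a
    z∈ = subst (z ∈_) (sym lone) (here refl)
    only-z : ∀ {x} → x ∈ halfSlots v β a → x ≡ z
    only-z x∈ with subst (_ ∈_) lone x∈
    ... | here x≡z = x≡z
    missing : ∀ {k} → ClassIn (slots v β) k → k ≢ (a , not (secondBit z))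
    missing (x , x∈ , refl) k≡k* =
      let x≡z = only-z (subst (λ a → x ∈ halfSlots v β a) (cong proj₁ k≡k*) (halfSlots⁺ x∈))
      in  Bool.not-¬ refl (trans (cong secondBit (sym x≡z)) (cong proj₂ k≡k*))
    present : ∀ k → k ≢ (a , not (secondBit z)) → ClassIn (slots v β) k
    present (a′ , b′) k≢k* with a′ Bool.≟ a
    ... | yes refl = z , proj₁ (halfSlots⁻ z∈) , cong₂ _,_ (proj₂ (halfSlots⁻ z∈))
                       (sym (trans (Bool.¬-not (k≢k* ∘ cong (a ,_))) (Bool.not-involutive _)))
    ... | no a′≢a  = subst (λ a″ → ClassIn (slots v β) (a″ , b′)) (sym (Bool.¬-not a′≢a))
                       (halfSlots-covers two b′)

  edgeClass : Edge → Class
  edgeClass e = class (inj₁ e)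

  classEdges : Vertex → Class → List Edge
  classEdges v k = filter (λ e → edgeClass e ≟ᶜ k) (incident v)

  classEdges⁻ : ∀ {v k e} → e ∈ classEdges v k → e ∈ incident v × edgeClass e ≡ k
  classEdges⁻ {v} {k} = ∈-filter⁻ (λ e → edgeClass e ≟ᶜ k) {xs = incident v}

  classEdges⁺ : ∀ {v e} → e ∈ incident v → e ∈ classEdges v (edgeClass e)
  classEdges⁺ e∈ = ∈-filter⁺ (λ e → _ ≟ᶜ _) e∈ refl

  unique-classEdges : ∀ v k → Unique (classEdges v k)
  unique-classEdges v k = Unique.filter⁺ _ (unique-incident v)

  -- two edges at v of one class cannot lie on the same side, where slot classes are distinct
  classEdges-≤2 : ∀ v k → length (classEdges v k) ≤ 2
  classEdges-≤2 v k = separating-list-≤2 (outAt v) (unique-classEdges v k) opposite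
    where
    opposite : ∀ {e f} → e ∈ classEdges v k → f ∈ classEdges v k → e ≢ f → outAt v e ≢ outAt v f
    opposite e∈ f∈ e≢f same =
      let e∈inc , e-k = classEdges⁻ e∈
          f∈inc , f-k = classEdges⁻ f∈
      in  slot-classes-distinct (edge-slot (out⁺ e∈inc))
            (edge-slot (subst (λ β → _ ∈ out v β) (sym same) (out⁺ f∈inc)))
            (λ { refl → e≢f refl }) (trans e-k (sym f-k))

  taggedClassEdges : Vertex × Class → List (Edge × Bool)
  taggedClassEdges (v , k) = map (endAt v) (classEdges v k)

  classSite : Edge × Bool → Vertex × Class
  classSite (e , b) = endpoint (e , b) , edgeClass e

  classSite-at : ∀ vk {a} → a ∈ taggedClassEdges vk → classSite a ≡ vk
  classSite-at (v , k) a∈ with ∈-map⁻ (endAt v) a∈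
  ... | e , e∈ , refl = let e∈inc , e-k = classEdges⁻ e∈ in cong₂ _,_ (endpoint-endAt e∈inc) e-k

  abstract
    balancedParity : ∃[ o ] ∀ vk → All (EdgeEnds.Splits o) (pairUp (taggedClassEdges vk))
    balancedParity = EdgeEnds.orientSites (vertices ×ₑ (enumBool ×ₑ enumBool)) taggedClassEdges
                       (λ (v , k) → unique-edgeEnds v (unique-classEdges v k)) classSite classSite-at

  parity : Edge → Bool
  parity = proj₁ balancedParity

  parityAt : Vertex → Edge → Bool
  parityAt v e = parity e xor isSecond e v

  parityAt-separates : ∀ v k → All (Separated (parityAt v)) (pairUp (classEdges v k))
  parityAt-separates v k = All-pairUp-map⁻ (endAt v) (classEdges v k) (proj₂ balancedParity (v , k))

  -- bipartiteness turns the end-relative parity into a bit of the edge alone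
  bit : Edge → Bool
  bit e = parity e xor side (first e)

  bit-at : ∀ {e v} → e ∈ incident v → bit e ≡ parityAt v e xor side v
  bit-at {e} {v} e∈ with first e Fin.≟ v | incident⁻ e∈
  ... | yes refl      | _            = cong (_xor side (first e)) (sym (Bool.xor-identityʳ (parity e)))
  ... | no first≢v    | inj₁ first≡v = ⊥-elim (first≢v first≡v)
  ... | no _          | inj₂ refl    =
    trans (cong (parity e xor_) (Bool.¬-not (bipartite e))) (sym (Bool.xor-assoc (parity e) true (side v)))

  same-class-different-bits : ∀ {e f v} → e ∈ incident v → f ∈ incident v → e ≢ f →
                              edgeClass e ≡ edgeClass f → bit e ≢ bit f
  same-class-different-bits {e} {f} {v} e∈ f∈ e≢f e-f =
    separated-in-pair (parityAt v) (classEdges-≤2 v k) (parityAt-separates v k)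
      (classEdges⁺ e∈) (subst (λ k → f ∈ classEdges v k) (sym e-f) (classEdges⁺ f∈)) e≢f
    ∘ xor-cancelʳ (side v) ∘ λ bits → trans (sym (bit-at e∈)) (trans bits (bit-at f∈))
    where k = edgeClass e

  colouring : Edge → ℕ
  colouring e = colour (bit e) (edgeClass e)

  proper : ProperColoring G 8 colouring
  proper = (λ e → colour-inRange (bit e) (edgeClass e)) ,
           λ { e f (e≢f , v , e∼v , f∼v) same →
               let bit≡ , class≡ = colour-injective same
               in  same-class-different-bits (incident⁺ e∼v) (incident⁺ f∼v) e≢f class≡ bit≡ }

  Colours : Vertex → ℕ → Set
  Colours = InS G colouring

  CyclicAt : Vertex → Set
  CyclicAt v = Consecutive (Colours v) ⊎ Consecutive (Complement (Colours v))

  class-colours : ∀ {v e f k} → e ∈ incident v → f ∈ incident v → e ≢ f →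
                  edgeClass e ≡ k → edgeClass f ≡ k → ∀ {c} → ColoursOf (_≡ k) c → Colours v c
  class-colours {e = e} {f} e∈ f∈ e≢f e-k f-k {c} (r , c-k) with bit e Bool.≟ bitOf c
  ... | yes e-b = e , incident⁻ e∈ , trans (cong₂ colour e-b (trans e-k (sym c-k))) (colour-decode r)
  ... | no e≢b  = f , incident⁻ f∈ ,
                  trans (cong₂ colour f-b (trans f-k (sym c-k))) (colour-decode r)
    where
    f-b : bit f ≡ bitOf c
    f-b = trans (Bool.¬-not (same-class-different-bits e∈ f∈ e≢f (trans e-k (sym f-k)) ∘ sym))
                (sym (Bool.¬-not (e≢b ∘ sym)))

  Meets : Vertex → Bool → Class → Set
  Meets v β k = ∃[ e ] (e ∈ out v β × edgeClass e ≡ k)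

  edge-meets : ∀ {e v} → e ∈ incident v → Meets v (outAt v e) (edgeClass e)
  edge-meets e∈ = _ , out⁺ e∈ , refl

  no-virtual : ∀ {v β x} → virtual v ≡ [] → x ∈ slots v β → ∃[ e ] (e ∈ out v β × x ≡ inj₁ e)
  no-virtual none x∈ with slot-cases x∈
  ... | inj₁ edge    = edge
  ... | inj₂ virtual = case subst (_ ∈_) none virtual of λ ()

  meets-of-slot : ∀ {v β k} → virtual v ≡ [] → ClassIn (slots v β) k → Meets v β k
  meets-of-slot none (x , x∈ , x-k) with no-virtual none x∈
  ... | e , e∈ , refl = e , e∈ , x-k

  slot-of-meets : ∀ {v β k} → Meets v β k → ClassIn (slots v β) k
  slot-of-meets (e , e∈ , e-k) = inj₁ e , edge-slot e∈ , e-k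

  even-slots : ∀ {v j} → degree G v ≡ j + j → j + length (padding (j + j)) ≡ 4 → ∀ β → length (slots v β) ≡ 4
  even-slots {v} deg≡ fill β =
    trans (slots-length v β) (trans (cong₂ _+_ (out-even deg≡ β) (cong (length ∘ padding) deg≡)) fill)

  virtual-of : ∀ {v d} → degree G v ≡ d → virtual v ≡ map (λ j → inj₂ (v , j)) (padding d)
  virtual-of {v} = cong (map (λ j → inj₂ (v , j)) ∘ padding)

  module EvenVertex {v} (four : ∀ β → length (slots v β) ≡ 4) where

    -- virtual slots lie on both sides, so both sides of v meet the same edge classes
    meets-opposite : ∀ {β k} → Meets v β k → Meets v (not β) k
    meets-opposite {β} {k} (e , e∈ , e-k) with slots-cover (four (not β)) k
    ... | x , x∈ , x-k with slot-cases x∈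
    ...   | inj₁ (f , f∈ , refl) = f , f∈ , x-k
    ...   | inj₂ x∈virtual       = ⊥-elim (slot-classes-distinct (virtual-slot β x∈virtual) (edge-slot e∈)
                                             (virtual-not-edge x∈virtual) (trans x-k (sym e-k)))

    meets-true : ∀ {β k} → Meets v β k → Meets v true k
    meets-true {true}  = λ meets → meets
    meets-true {false} = meets-opposite

    even-colours : ∀ c → Colours v c ⇔ ColoursOf (Meets v true) c
    even-colours c = mk⇔ to from
      where
      to : Colours v c → ColoursOf (Meets v true) c
      to (e , e∼v , refl) =
        colour-inRange (bit e) (edgeClass e) ,
        subst (Meets v true) (sym (proj₂ (decode-colour (bit e) (edgeClass e))))
              (meets-true (edge-meets (incident⁺ e∼v)))
      from : ColoursOf (Meets v true) c → Colours v c
      from (r , meets@(o , o∈ , o-k)) =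
        let i , i∈ , i-k = meets-opposite meets
        in  class-colours (proj₁ (out⁻ o∈)) (proj₁ (out⁻ i∈)) (out-opposite o∈ i∈) o-k i-k (r , refl)

    colours-by : ∀ {K : Class → Set} → (∀ k → Meets v true k ⇔ K k) → ∀ c → Colours v c ⇔ ColoursOf K c
    colours-by meets⇔ c = ColoursOf-resp-⇔ meets⇔ c ⇔-∘ even-colours c

  degree-one : ∀ {v} → degree G v ≡ 1 → CyclicAt v
  degree-one {v} deg≡ with length≡1 deg≡
  ... | e , incident≡ = inj₁ (singleton-consecutive (colouring e) λ c → mk⇔ to (from c))
    where
    to : ∀ {c} → Colours v c → c ≡ colouring e
    to (f , f∼v , refl) = cong colouring (Any.singleton⁻ (subst (f ∈_) incident≡ (incident⁺ f∼v)))
    from : ∀ c → c ≡ colouring e → Colours v c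
    from _ refl = e , incident⁻ (subst (e ∈_) (sym incident≡) (here refl)) , refl

  degree-two : ∀ {v} → degree G v ≡ 2 → CyclicAt v
  degree-two {v} deg≡ with length≡1 (out-even {j = 1} deg≡ true)
  ... | o , out≡ = inj₁ (Consecutive-resp-⇔ (colours-by meets⇔) (single-class-consecutive (edgeClass o)))
    where
    open EvenVertex (even-slots {j = 1} deg≡ refl)
    meets⇔ : ∀ k → Meets v true k ⇔ k ≡ edgeClass o
    meets⇔ k = mk⇔
      (λ (e , e∈ , e-k) → trans (sym e-k) (cong edgeClass (Any.singleton⁻ (subst (e ∈_) out≡ e∈))))
      (λ k≡ → o , subst (o ∈_) (sym out≡) (here refl) , sym k≡)

  degree-four : ∀ {v} → degree G v ≡ 4 → CyclicAt v
  degree-four {v} deg≡ with length≡2 (out-even {j = 2} deg≡ true)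
  ... | o₁ , o₂ , out≡ =
    Sum.map (Consecutive-resp-⇔ (colours-by meets⇔)) (Consecutive-resp-⇔ (Complement-resp-⇔ (colours-by meets⇔)))
            (two-classes-consecutive (edgeClass o₁) (edgeClass o₂) first-bits-differ)
    where
    open EvenVertex (even-slots {j = 2} deg≡ refl)
    first-bits-differ : firstBit (inj₁ o₁) ≢ firstBit (inj₁ o₂)
    first-bits-differ = All.head (subst (All (Separated firstBit) ∘ pairUp ∘ (_++ virtual v) ∘ map inj₁) out≡
                                        (firstBit-separates v true))
    meets⇔ : ∀ k → Meets v true k ⇔ TwoClasses (edgeClass o₁) (edgeClass o₂) k
    meets⇔ k = mk⇔ to from
      where
      to : Meets v true k → TwoClasses (edgeClass o₁) (edgeClass o₂) k
      to (e , e∈ , e-k) with subst (e ∈_) out≡ e∈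
      ... | here refl         = inj₁ (sym e-k)
      ... | there (here refl) = inj₂ (sym e-k)
      from : TwoClasses (edgeClass o₁) (edgeClass o₂) k → Meets v true k
      from (inj₁ k≡) = o₁ , subst (o₁ ∈_) (sym out≡) (here refl) , sym k≡
      from (inj₂ k≡) = o₂ , subst (o₂ ∈_) (sym out≡) (there (here refl)) , sym k≡

  degree-six : ∀ {v} → degree G v ≡ 6 → CyclicAt v
  degree-six {v} deg≡ =
    inj₂ (Consecutive-resp-⇔ (λ c → complement-of-others (class lone) c ⇔-∘ Complement-resp-⇔ (colours-by meets⇔) c)
                             (single-class-consecutive (class lone)))
    where
    open EvenVertex (even-slots {j = 3} deg≡ refl)
    lone : Slot
    lone = inj₂ (v , zero)
    lone∈ : ∀ β → lone ∈ slots v β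
    lone∈ β = virtual-slot β (subst (lone ∈_) (sym (virtual-of deg≡)) (here refl))
    meets⇔ : ∀ k → Meets v true k ⇔ k ≢ class lone
    meets⇔ k = mk⇔ to from
      where
      to : Meets v true k → k ≢ class lone
      to (e , e∈ , refl) = slot-classes-distinct (edge-slot e∈) (lone∈ true) (λ ())
      from : k ≢ class lone → Meets v true k
      from k≢ with slots-cover (even-slots {j = 3} deg≡ refl true) k
      ... | x , x∈ , x-k with slot-cases x∈
      ...   | inj₁ (e , e∈ , refl) = e , e∈ , x-k
      ...   | inj₂ x∈virtual with subst (x ∈_) (virtual-of deg≡) x∈virtual
      ...     | here refl = ⊥-elim (k≢ (sym x-k))

  degree-eight : ∀ {v} → degree G v ≡ 8 → CyclicAt v
  degree-eight {v} deg≡ = inj₁ (1 , 8 , λ c → mk⇔ proj₁ (λ r → r , meets-all _) ⇔-∘ even-colours c)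
    where
    open EvenVertex (even-slots {j = 4} deg≡ refl)
    meets-all : ∀ k → Meets v true k
    meets-all k = meets-of-slot (virtual-of deg≡) (slots-cover (even-slots {j = 4} deg≡ refl true) k)

  odd-slots : ∀ {v β ℓ} → degree G v ≡ 7 → length (out v β) ≡ ℓ → length (slots v β) ≡ ℓ
  odd-slots {v} {β} {ℓ} deg≡ ℓ≡ =
    trans (slots-length v β) (trans (cong₂ _+_ ℓ≡ (cong (length ∘ padding) deg≡)) (+-identityʳ ℓ))

  module SevenVertex {v β} (meets-β : ∀ k → Meets v β k) (missed : Class)
                     (meets-other⇔ : ∀ k → Meets v (not β) k ⇔ k ≢ missed) where

    witness : Edge
    witness = proj₁ (meets-β missed)

    witness∈ : witness ∈ out v β
    witness∈ = proj₁ (proj₂ (meets-β missed))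

    witness-class : edgeClass witness ≡ missed
    witness-class = proj₂ (proj₂ (meets-β missed))

    -- the missed class is met by a single edge, so exactly one of its two colours is missing
    missingColour : ℕ
    missingColour = colour (not (bit witness)) missed

    absent : ¬ Colours v missingColour
    absent (e , e∼v , col≡) with colour-injective col≡ | outAt v e Bool.≟ β
    ... | bit≡ , class≡ | yes out≡ with e Fin.≟ witness
    ...   | yes refl = Bool.not-¬ refl bit≡
    ...   | no e≢w   = slot-classes-distinct (edge-slot (subst (λ β → e ∈ out v β) out≡ (out⁺ (incident⁺ e∼v))))
                         (edge-slot witness∈) (λ { refl → e≢w refl }) (trans class≡ (sym witness-class))
    absent (e , e∼v , col≡) | bit≡ , class≡ | no out≢ =
      Equivalence.to (meets-other⇔ missed)
        (e , subst (λ β → e ∈ out v β) (Bool.¬-not out≢) (out⁺ (incident⁺ e∼v)) , class≡) refl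

    present : ∀ {c} → InRange c → c ≢ missingColour → Colours v c
    present {c} r c≢ with classOf c ≟ᶜ missed
    ... | yes c-k = witness , incident⁻ (proj₁ (out⁻ witness∈)) ,
                    trans (cong₂ colour (sym bit≡) (trans witness-class (sym c-k))) (colour-decode r)
      where
      bit≡ : bitOf c ≡ bit witness
      bit≡ = trans (Bool.¬-not (λ b≡ → c≢ (trans (sym (colour-decode r)) (cong₂ colour b≡ c-k))))
                   (Bool.not-involutive _)
    ... | no c≢k =
      let e , e∈ , e-k = meets-β (classOf c)
          f , f∈ , f-k = Equivalence.from (meets-other⇔ (classOf c)) c≢k
      in  class-colours (proj₁ (out⁻ e∈)) (proj₁ (out⁻ f∈)) (out-opposite e∈ f∈) e-k f-k (r , refl)

    complement-is-missingColour : ∀ c → Complement (Colours v) c ⇔ c ≡ missingColour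
    complement-is-missingColour c = mk⇔ to (λ { refl → colour-inRange _ _ , absent })
      where
      to : Complement (Colours v) c → c ≡ missingColour
      to (r , uncoloured) with c ℕ.≟ missingColour
      ... | yes c≡ = c≡
      ... | no c≢  = ⊥-elim (uncoloured (present r c≢))

  degree-seven : ∀ {v} → degree G v ≡ 7 → CyclicAt v
  degree-seven {v} deg≡ with out-odd {j = 3} deg≡
  ... | β , four-out , three-out with slots-miss-one (odd-slots deg≡ three-out)
  ...   | missed , classes⇔ = inj₂ (singleton-consecutive _ complement-is-missingColour)
    where
    meets-β : ∀ k → Meets v β k
    meets-β k = meets-of-slot (virtual-of deg≡) (slots-cover (odd-slots deg≡ four-out) k)
    open SevenVertex meets-β missed (λ k → classes⇔ k ⇔-∘ mk⇔ slot-of-meets (meets-of-slot (virtual-of deg≡)))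

  cyclic-at : ∀ v → CyclicAt v
  cyclic-at v with allowed v
  ... | inj₁ deg≡                                   = degree-one deg≡
  ... | inj₂ (inj₁ deg≡)                            = degree-two deg≡
  ... | inj₂ (inj₂ (inj₁ deg≡))                     = degree-four deg≡
  ... | inj₂ (inj₂ (inj₂ (inj₁ deg≡)))              = degree-six deg≡
  ... | inj₂ (inj₂ (inj₂ (inj₂ (inj₁ deg≡))))       = degree-seven deg≡
  ... | inj₂ (inj₂ (inj₂ (inj₂ (inj₂ deg≡))))       = degree-eight deg≡

corollary4 : (G : Graph) → Bipartite G →
  (∀ v → (degree G v ≡ 1) ⊎ (degree G v ≡ 2) ⊎ (degree G v ≡ 4)
       ⊎ (degree G v ≡ 6) ⊎ (degree G v ≡ 7) ⊎ (degree G v ≡ 8)) →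
  ∃[ t ] (1 ≤ t × Σ (Fin (m G) → ℕ) (λ α → CyclicIntervalColoring G t α))
corollary4 G (side , bipartite) allowed = 8 , s≤s z≤n , colouring , proper , cyclic-at
  where open Construction G side bipartite allowed
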